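{- Let $(Z,E)$ be a reflexive graph (i.e. $Z$ is a nonempty set and $E\subseteq Z\times Z$ is reflexive) and let $R\subseteq Z\times Z$ be any relation. 1. The following are equivalent: (i) $(R^{[0]}[y])^{[10]}\subseteq R^{[0]}[y]$ for every $y\in Z$; (ii) $(R^{[0]}[Y])^{[10]}\subseteq R^{[0]}[Y]$ for every $Y\subseteq Z$; (iii) $R^{[1]}[B]=R^{[1]}[B^{[10]}]$ for every $B\subseteq Z$. 2. The following are equivalent: (i) $(R^{[1]}[b])^{[01]}\subseteq R^{[1]}[b]$ for every $b\in Z$; (ii) $(R^{[1]}[B])^{[01]}\subseteq R^{[1]}[B]$ for every $B\subseteq Z$; (iii) $R^{[0]}[Y]=R^{[0]}[Y^{[01]}]$ for every $Y\subseteq Z$.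
   Context: For a relation $T\subseteq U\times V$ and $U'\subseteq U$, $V'\subseteq V$: $T^{[1]}[U']=\{v\in V\mid \forall u\in U'\,((u,v)\notin T)\}$ and $T^{[0]}[V']=\{u\in U\mid \forall v\in V'\,((u,v)\notin T)\}$; for singletons write $T^{[1]}[u]$, $T^{[0]}[v]$. For the graph, abbreviate $B^{[1]}:=E^{[1]}[B]$ and $Y^{[0]}:=E^{[0]}[Y]$ for $B,Y\subseteq Z$, and $B^{[10]}:=(B^{[1]})^{[0]}$, $Y^{[01]}:=(Y^{[0]})^{[1]}$. -}

module Defs where

open import Level using (Level)
open import Data.Product using (_×_)
open import Relation.Nullary using (¬_)
open import Relation.Unary using (Pred; _⊆_; ｛_｝)
open import Relation.Binary.PropositionalEquality using (_≡_)

Rel₂ : {ℓ : Level} → Set ℓ → Set ℓ → Set _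
Rel₂ {ℓ} U V = U → V → Set ℓ

pol1 : {ℓ : Level} {U V : Set ℓ} → Rel₂ U V → Pred U ℓ → Pred V ℓ
pol1 T U' v = ∀ u → U' u → ¬ T u v

pol0 : {ℓ : Level} {U V : Set ℓ} → Rel₂ U V → Pred V ℓ → Pred U ℓ
pol0 T V' u = ∀ v → V' v → ¬ T u v

_≐_ : {ℓ : Level} {A : Set ℓ} → Pred A ℓ → Pred A ℓ → Set ℓ
P ≐ Q = (P ⊆ Q) × (Q ⊆ P)

record ReflexiveGraph {ℓ : Level} (Z : Set ℓ) (E : Rel₂ Z Z) : Set ℓ where
  field
    point : Z
    refl  : ∀ z → E z z

-- B^[1] := E^[1][B] = pol1 E B,  Y^[0] := E^[0][Y] = pol0 E Y
-- B^[10] = (B^[1])^[0] ;  Y^[01] = (Y^[0])^[1]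
cl10 : {ℓ : Level} {Z : Set ℓ} (E : Rel₂ Z Z) → Pred Z ℓ → Pred Z ℓ
cl10 E B = pol0 E (pol1 E B)
cl01 : {ℓ : Level} {Z : Set ℓ} (E : Rel₂ Z Z) → Pred Z ℓ → Pred Z ℓ
cl01 E Y = pol1 E (pol0 E Y)

-- The polars R^[0], R^[1] and E^[0], E^[1] are Galois connections, so
-- Y ⊆ R^[1][A] ⇔ A ⊆ R^[0][Y] and B ↦ B^[10] is a closure operator.
-- Every R^[0][Y] is the intersection of the R^[0][y], y ∈ Y, so closedness of the
-- pointwise polars gives closedness of all of them; and R^[1][B] = R^[1][B^[10]]
-- says, through the Galois connection, that each R^[0][{v}] containing B contains
-- B^[10]. Part 2 is part 1 for the converse relations, as T^[1] is (flip T)^[0].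
module Submission where

open import Defs
open import Level using (Level)
open import Data.Product using (_×_; _,_; proj₁)
open import Function using (flip; id; _∘′_)
open import Function.Bundles using (_⇔_; mk⇔)
open import Relation.Binary.PropositionalEquality using (refl; subst)
open import Relation.Unary using (Pred; _⊆_; ｛_｝)

module _ {ℓ : Level} {U V : Set ℓ} (T : Rel₂ U V) where

  ⊆pol1⇒⊆pol0 : {A : Pred U ℓ} {Y : Pred V ℓ} → Y ⊆ pol1 T A → A ⊆ pol0 T Y
  ⊆pol1⇒⊆pol0 Y⊆ a v v∈Y = Y⊆ v∈Y _ a

  ⊆pol0⇒⊆pol1 : {A : Pred U ℓ} {Y : Pred V ℓ} → A ⊆ pol0 T Y → Y ⊆ pol1 T A
  ⊆pol0⇒⊆pol1 A⊆ y u u∈A = A⊆ u∈A _ y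

  ⊆pol0-pol1 : (A : Pred U ℓ) → A ⊆ pol0 T (pol1 T A)
  ⊆pol0-pol1 A = ⊆pol1⇒⊆pol0 id

  pol0-antitone : {Y Y′ : Pred V ℓ} → Y ⊆ Y′ → pol0 T Y′ ⊆ pol0 T Y
  pol0-antitone Y⊆Y′ u∈ v v∈Y = u∈ v (Y⊆Y′ v∈Y)

  pol1-antitone : {A A′ : Pred U ℓ} → A ⊆ A′ → pol1 T A′ ⊆ pol1 T A
  pol1-antitone A⊆A′ v∈ u u∈A = v∈ u (A⊆A′ u∈A)

  ∈pol1⇒｛｝⊆pol1 : {A : Pred U ℓ} {v : V} → pol1 T A v → ｛ v ｝ ⊆ pol1 T A
  ∈pol1⇒｛｝⊆pol1 v∈ refl = v∈

module _ {ℓ : Level} {Z : Set ℓ} (E : Rel₂ Z Z) where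

  ⊆cl10 : (B : Pred Z ℓ) → B ⊆ cl10 E B
  ⊆cl10 = ⊆pol0-pol1 E

  cl10-monotone : {A B : Pred Z ℓ} → A ⊆ B → cl10 E A ⊆ cl10 E B
  cl10-monotone A⊆B = pol0-antitone E (pol1-antitone E A⊆B)

module _ {ℓ : Level} {Z : Set ℓ} (E R : Rel₂ Z Z) where

  PointPolarsClosed : Set ℓ
  PointPolarsClosed = ∀ (y : Z) → cl10 E (pol0 R ｛ y ｝) ⊆ pol0 R ｛ y ｝

  PolarsClosed : Set (Level.suc ℓ)
  PolarsClosed = ∀ (Y : Pred Z ℓ) → cl10 E (pol0 R Y) ⊆ pol0 R Y

  Pol1-cl10-invariant : Set (Level.suc ℓ)
  Pol1-cl10-invariant = ∀ (B : Pred Z ℓ) → pol1 R B ≐ pol1 R (cl10 E B)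

  pointPolarsClosed⇒polarsClosed : PointPolarsClosed → PolarsClosed
  pointPolarsClosed⇒polarsClosed closed Y = ⊆pol1⇒⊆pol0 R Y⊆
    where
    Y⊆ : Y ⊆ pol1 R (cl10 E (pol0 R Y))
    Y⊆ {y} y∈Y = ⊆pol0⇒⊆pol1 R
      (λ u∈ → closed y (cl10-monotone E (pol0-antitone R (λ { refl → y∈Y })) u∈))
      refl

  polarsClosed⇒pol1-cl10-invariant : PolarsClosed → Pol1-cl10-invariant
  polarsClosed⇒pol1-cl10-invariant closed B =
      (λ {v} v∈ → ⊆pol0⇒⊆pol1 R (B^[10]⊆ v∈) refl)
    , pol1-antitone R (⊆cl10 E B)
    where
    B^[10]⊆ : {v : Z} → pol1 R B v → cl10 E B ⊆ pol0 R ｛ v ｝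
    B^[10]⊆ {v} v∈ = closed ｛ v ｝ ∘′ cl10-monotone E (⊆pol1⇒⊆pol0 R (∈pol1⇒｛｝⊆pol1 R v∈))

  pol1-cl10-invariant⇒polarsClosed : Pol1-cl10-invariant → PolarsClosed
  pol1-cl10-invariant⇒polarsClosed invariant Y =
    ⊆pol1⇒⊆pol0 R (λ y∈Y → proj₁ (invariant (pol0 R Y)) (⊆pol0⇒⊆pol1 R id y∈Y))

  polarsClosed-equivalences : (PointPolarsClosed ⇔ PolarsClosed) × (PolarsClosed ⇔ Pol1-cl10-invariant)
  polarsClosed-equivalences =
      mk⇔ pointPolarsClosed⇒polarsClosed (λ closed y → closed ｛ y ｝)
    , mk⇔ polarsClosed⇒pol1-cl10-invariant pol1-cl10-invariant⇒polarsClosed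

lemma4 : {ℓ : Level} {Z : Set ℓ} (E : Rel₂ Z Z) → ReflexiveGraph Z E → (R : Rel₂ Z Z) →
    -- part 1
    (((∀ (y : Z) → cl10 E (pol0 R ｛ y ｝) ⊆ pol0 R ｛ y ｝) ⇔ (∀ (Y : Pred Z ℓ) → cl10 E (pol0 R Y) ⊆ pol0 R Y))
      × ((∀ (Y : Pred Z ℓ) → cl10 E (pol0 R Y) ⊆ pol0 R Y) ⇔ (∀ (B : Pred Z ℓ) → pol1 R B ≐ pol1 R (cl10 E B))))
    ×
    -- part 2
    (((∀ (b : Z) → cl01 E (pol1 R ｛ b ｝) ⊆ pol1 R ｛ b ｝) ⇔ (∀ (B : Pred Z ℓ) → cl01 E (pol1 R B) ⊆ pol1 R B))
      × ((∀ (B : Pred Z ℓ) → cl01 E (pol1 R B) ⊆ pol1 R B) ⇔ (∀ (Y : Pred Z ℓ) → pol0 R Y ≐ pol0 R (cl01 E Y))))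
lemma4 E _ R = polarsClosed-equivalences E R , polarsClosed-equivalences (flip E) (flip R)
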